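{- Let $\langle B,S\rangle$ be an Induction Model, where $S$ is a $k$-ary function. Then $\langle B,S\rangle$ can be reduced to $\langle \{1\}, x\mapsto x+1\rangle$.
   Context: $\mathbb{N}=\{1,2,\dots\}$. An Induction Model is a pair $\langle B,S\rangle$ with $B\subset\mathbb{N}$ and $S:\mathbb{N}^k\to\mathbb{Z}$. For $A\subseteq\mathbb{N}$, $S(A)=\{S(x_1,\dots,x_k):x_j\in A\}\cap\mathbb{N}$. $S^0(B)=B$, $S^i(B)=\{S(x_1,\dots,x_k): x_j\in\bigcup_{j'<i}S^{j'}(B)\}\cap\mathbb{N}$; $Cl_n(\langle B,S\rangle)=\bigcup_{i=0}^nS^i(B)$, $Cl(\langle B,S\rangle)=\bigcup_{i\ge0}S^i(B)$; $l(x,\langle B,S\rangle)=\min\{i\ge0:x\in S^i(B)\}$. An injective version $S_{inj}$ is obtained by choosing for each $x\in Cl(\langle B,S\rangle)\setminus B$ a tuple $\mathbf{n}_x$ with entries in $Cl_{l(x)-1}(\langle B,S\rangle)$ and $S(\mathbf{n}_x)=x$, and setting $S_{inj}(\mathbf{n})=S(\mathbf{n})$ if $\mathbf{n}=\mathbf{n}_x$ for some $x$, else $0$. With $S_1$ $k_1$-ary and $S_2$ $k_2$-ary, $\langle B_1,S_1\rangle$ can be reduced to $\langle B_2,S_2\rangle$ if, for an injective version $S_{2,inj}$ of $S_2$, there is a map $R:Cl(\langle B_2,S_2\rangle)\to2^{Cl(\langle B_1,S_1\rangle)}$ with (1) $\bigcup_{x\in Cl(\langle B_2,S_2\rangle)}R(x)=Cl(\langle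 B_1,S_1\rangle)$; (2) $\bigcup_{x\in B_2}R(x)=B_1$; (3) for every $x\in Cl(\langle B_2,S_2\rangle)\setminus B_2$, with $x=S_{2,inj}(n_1,\dots,n_{k_2})$ for the chosen tuple $(n_1,\dots,n_{k_2})=\mathbf{n}_x$, $R(x)=S_1\big(\bigcup_{i=1}^{k_2}R(n_i)\big)\cup\bigcup_{i=1}^{k_2}R(n_i)$. -}

module Defs where

open import Data.Nat using (ℕ; zero; suc; _≤_; _<_)
open import Data.Integer using (ℤ; +_)
open import Data.Fin using (Fin; zero)
open import Data.Product using (Σ; _×_; ∃)
open import Data.Sum using (_⊎_)
open import Relation.Nullary using (¬_)
open import Relation.Binary.PropositionalEquality using (_≡_)
open import Function.Bundles using (_⇔_)

-- The paper's ℕ = {1,2,...} is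
-- modelled as the elements x : ℕ with 1 ≤ x; every set built below is
-- intersected with {x | 1 ≤ x}, and B is assumed to satisfy 1 ≤ x.
Pred : Set₁
Pred = ℕ → Set

module Model {k : ℕ} (B : Pred) (S : (Fin k → ℕ) → ℤ) where

  Img : Pred → Pred
  Img A y = (1 ≤ y) × Σ (Fin k → ℕ) (λ xs → (∀ j → A (xs j)) × (S xs ≡ + y))

  -- Cl_n(⟨B,S⟩) = ⋃_{i ≤ n} S^i(B)
  Clₙ : ℕ → Pred
  Clₙ zero = B
  Clₙ (suc n) y = Clₙ n y ⊎ Img (Clₙ n) y

  -- S^i(B): S^0(B) = B, S^{i+1}(B) = S(⋃_{j ≤ i} S^j(B)) = S(Cl_i)
  Lev : ℕ → Pred
  Lev zero = B
  Lev (suc i) = Img (Clₙ i)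

  Cl : Pred
  Cl y = ∃ λ n → Lev n y

  IsLevel : ℕ → ℕ → Set
  IsLevel x i = Lev i x × (∀ j → j < i → ¬ Lev j x)

  -- The data of an injective version S_inj: a choice x ↦ n_x of a tuple
  -- for each x ∈ Cl \ B, with entries in Cl_{l(x)-1} and S(n_x) = x.
  -- (S_inj(n) = S(n) if n = n_x for some x, else 0; only the n_x matter.)
  IsInjChoice : (ℕ → Fin k → ℕ) → Set
  IsInjChoice nx = ∀ x → Cl x → ¬ B x →
    Σ ℕ λ m → IsLevel x (suc m) × (∀ j → Clₙ m (nx x j)) × (S (nx x) ≡ + x)

ReducibleTo : {k₁ k₂ : ℕ} → (B₁ : Pred) → (S₁ : (Fin k₁ → ℕ) → ℤ)
            → (B₂ : Pred) → (S₂ : (Fin k₂ → ℕ) → ℤ) → Set₁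
ReducibleTo {k₁} {k₂} B₁ S₁ B₂ S₂ =
  Σ (ℕ → Fin k₂ → ℕ) λ nx → M₂.IsInjChoice nx ×
  Σ (ℕ → Pred) λ R →
      (∀ y → (M₁.Cl y ⇔ (∃ λ x → M₂.Cl x × R x y)))
    × (∀ y → (B₁ y ⇔ (∃ λ x → B₂ x × R x y)))
    × (∀ x → M₂.Cl x → ¬ B₂ x → ∀ y →
         (R x y ⇔ (M₁.Img (U R nx x) y ⊎ U R nx x y)))
  where
    module M₁ = Model B₁ S₁
    module M₂ = Model B₂ S₂
    U : (ℕ → Pred) → (ℕ → Fin k₂ → ℕ) → ℕ → Pred
    U R nx x y = ∃ λ i → R (nx x i) y

OneB : Pred
OneB x = x ≡ 1

SucS : (Fin 1 → ℕ) → ℤ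
SucS xs = + suc (xs zero)

{-# OPTIONS --safe #-}
-- In ⟨{1}, x ↦ x+1⟩ the element n+1 lies exactly at level n and is produced
-- from the single argument n, and all of its levels are bounded: level j only
-- contains numbers ≤ j+1.  Setting R(n+1) := Cl_n(⟨B,S⟩), the reduction
-- condition R(n+1) = S(R n) ∪ R n is then just the recursion defining Cl_n,
-- R 1 = B, and the union of all R(n) is Cl(⟨B,S⟩).
module Submission where

open import Defs
open import Data.Nat using (ℕ; zero; suc; pred; _≤_; z≤n; s≤s)
open import Data.Nat.Properties using (≤-trans; n≤1+n; <⇒≱)
open import Data.Integer using (ℤ)
open import Data.Fin using (Fin; zero)
open import Data.Product using (∃; _×_; _,_; proj₂)
open import Data.Sum using (_⊎_; inj₁; inj₂)
open import Data.Empty using (⊥-elim)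
open import Relation.Nullary using (¬_)
open import Relation.Binary.PropositionalEquality using (refl)
open import Function.Bundles using (_⇔_; mk⇔; module Equivalence)

module ModelProperties {k : ℕ} (B : Pred) (S : (Fin k → ℕ) → ℤ) where
  open Model B S

  Lev⊆Clₙ : ∀ n {y} → Lev n y → Clₙ n y
  Lev⊆Clₙ zero    p = p
  Lev⊆Clₙ (suc n) p = inj₂ p

  Clₙ⊆Cl : ∀ n {y} → Clₙ n y → Cl y
  Clₙ⊆Cl zero    p        = zero , p
  Clₙ⊆Cl (suc n) (inj₁ p) = Clₙ⊆Cl n p
  Clₙ⊆Cl (suc n) (inj₂ p) = suc n , p

  Img-mono : {A A′ : Pred} → (∀ {z} → A z → A′ z) → ∀ {y} → Img A y → Img A′ y
  Img-mono A⊆A′ (1≤y , xs , xs∈A , Sxs≡y) = 1≤y , xs , (λ j → A⊆A′ (xs∈A j)) , Sxs≡y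

  Cl-unfold : ∀ n {A : Pred} → (∀ z → A z ⇔ Clₙ n z) →
              ∀ y → Clₙ (suc n) y ⇔ (Img A y ⊎ A y)
  Cl-unfold n {A} A≐Clₙ y = mk⇔ to from
    where
    to : Clₙ (suc n) y → Img A y ⊎ A y
    to (inj₁ p) = inj₂ (Equivalence.from (A≐Clₙ y) p)
    to (inj₂ p) = inj₁ (Img-mono (λ {z} → Equivalence.from (A≐Clₙ z)) p)
    from : Img A y ⊎ A y → Clₙ (suc n) y
    from (inj₁ p) = inj₂ (Img-mono (λ {z} → Equivalence.to (A≐Clₙ z)) p)
    from (inj₂ p) = inj₁ (Equivalence.to (A≐Clₙ y) p)

module Successor where
  open Model OneB SucS public
  open ModelProperties OneB SucS public

  Lev-bounded : ∀ j {y} → Lev j y → y ≤ suc j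
  Clₙ-bounded : ∀ j {y} → Clₙ j y → y ≤ suc j
  Lev-bounded zero    refl                       = s≤s z≤n
  Lev-bounded (suc j) (_ , xs , xs∈Clⱼ , refl) = s≤s (Clₙ-bounded j (xs∈Clⱼ zero))
  Clₙ-bounded zero    p        = Lev-bounded zero p
  Clₙ-bounded (suc j) (inj₁ p) = ≤-trans (Clₙ-bounded j p) (n≤1+n _)
  Clₙ-bounded (suc j) (inj₂ p) = Lev-bounded (suc j) p

  suc∈Lev : ∀ n → Lev n (suc n)
  suc∈Lev zero    = refl
  suc∈Lev (suc n) = s≤s z≤n , (λ _ → suc n) , (λ _ → Lev⊆Clₙ n (suc∈Lev n)) , refl

  level-suc : ∀ n → IsLevel (suc n) n
  level-suc n = suc∈Lev n , λ j j<n suc-n∈Levⱼ → <⇒≱ (s≤s j<n) (Lev-bounded j suc-n∈Levⱼ)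

  Cl-positive : ∀ {x} → Cl x → 1 ≤ x
  Cl-positive (zero  , refl)    = s≤s z≤n
  Cl-positive (suc i , 1≤x , _) = 1≤x

  predChoice : ℕ → Fin 1 → ℕ
  predChoice x _ = pred x

  predChoice-isInjChoice : IsInjChoice predChoice
  predChoice-isInjChoice zero          c _  with () ← Cl-positive c
  predChoice-isInjChoice (suc zero)    _ x≢1 = ⊥-elim (x≢1 refl)
  predChoice-isInjChoice (suc (suc m)) _ _  =
    m , level-suc (suc m) , (λ _ → Lev⊆Clₙ m (suc∈Lev m)) , refl

corollary1 : {k : ℕ} (B : Pred) (S : (Fin k → ℕ) → ℤ)
    → (∀ x → B x → 1 ≤ x)
    → ReducibleTo B S OneB SucS
corollary1 B S _ = predChoice , predChoice-isInjChoice , R , covers , base , step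
  where
  open Model B S
  open ModelProperties B S
  open Successor using (predChoice; predChoice-isInjChoice; suc∈Lev; Cl-positive)

  R : ℕ → Pred
  R x = Clₙ (pred x)

  covers : ∀ y → Cl y ⇔ (∃ λ x → Successor.Cl x × R x y)
  covers y = mk⇔ (λ (n , y∈Levₙ) → suc n , (n , suc∈Lev n) , Lev⊆Clₙ n y∈Levₙ)
                 (λ (x , _ , y∈Rx) → Clₙ⊆Cl (pred x) y∈Rx)

  base : ∀ y → B y ⇔ (∃ λ x → OneB x × R x y)
  base y = mk⇔ (λ y∈B → 1 , refl , y∈B) (λ { (.1 , refl , y∈R1) → y∈R1 })

  step : ∀ x → Successor.Cl x → ¬ OneB x → ∀ y →
         R x y ⇔ (Img (λ z → ∃ λ i → R (predChoice x i) z) y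
                  ⊎ (∃ λ i → R (predChoice x i) y))
  step zero          c _   with () ← Cl-positive c
  step (suc zero)    _ x≢1 = ⊥-elim (x≢1 refl)
  step (suc (suc m)) _ _   = Cl-unfold m λ z → mk⇔ proj₂ (zero ,_)
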